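{- (1) The reduction $\to^{\mathsf w}_{\sigma\beta_c}$ is uniformly normalizing. (2) The reduction $\to^{\mathsf s}_{\sigma\beta_c}$ is uniformly normalizing. Moreover, all maximal $\to^{\mathsf w}_{\sigma\beta_c}$-sequences (resp. all maximal $\to^{\mathsf s}_{\sigma\beta_c}$-sequences) from the same computation $M$ have the same number of $\beta_c$ steps.
   Context: The computational core $\lambda_{\copyright}$ has values $V,W ::= x \mid \lambda x.M$ and computations $M,N,L ::= \,!V \mid VM$ ($x$ ranging over a countable set of variables, terms up to $\alpha$-renaming). Rules: $\beta_c$: $(\lambda x.M)(!V) \mapsto M\{V/x\}$; $\sigma$: $(\lambda y.N)((\lambda x.M)L) \mapsto (\lambda x.(\lambda y.N)M)L$ provided $x\notin \mathrm{fv}(N)$; $\sigma\beta_c=\sigma\cup\beta_c$. Surface contexts $S ::= [\,]\mid VS\mid(\lambda x.S)M$; weak contexts $W ::= [\,]\mid VW$; $\to^{\mathsf s}_\rho$ / $\to^{\mathsf w}_\rho$ is closure of rule $\rho$ under surface / weak contexts. A maximal sequence is either infinite or ends in a normal form. A reduction $\to$ is uniformly normalizing if every term that is weakly $\to$-normalizing (has some $\to$-sequence ending in a $\to$-normal form) is strongly $\to$-normalizing (has no infinite $\to$-sequence). -}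

module Defs where

open import Data.Nat using (ℕ; zero; suc; _+_; _≤_)
open import Data.Fin using (Fin; zero; suc)
open import Data.Product using (Σ; ∃; ∃-syntax; _×_; _,_)
open import Data.Empty using (⊥)
open import Relation.Nullary using (¬_)
open import Relation.Binary.PropositionalEquality using (_≡_)

-- Syntax of the computational core λ©, with well-scoped de Bruijn
-- indices (so terms are identified up to α-renaming).
-- Val n / Comp n : values / computations with at most n free variables.

mutual
  data Val (n : ℕ) : Set where
    var : Fin n → Val n
    lam : Comp (suc n) → Val n

  data Comp (n : ℕ) : Set where
    ret : Val n → Comp n
    app : Val n → Comp n → Comp n

ext : ∀ {n m} → (Fin n → Fin m) → Fin (suc n) → Fin (suc m)
ext ρ zero    = zero
ext ρ (suc i) = suc (ρ i)

mutual
  renV : ∀ {n m} → (Fin n → Fin m) → Val n → Val m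
  renV ρ (var i) = var (ρ i)
  renV ρ (lam M) = lam (renC (ext ρ) M)

  renC : ∀ {n m} → (Fin n → Fin m) → Comp n → Comp m
  renC ρ (ret V)   = ret (renV ρ V)
  renC ρ (app V M) = app (renV ρ V) (renC ρ M)

exts : ∀ {n m} → (Fin n → Val m) → Fin (suc n) → Val (suc m)
exts σ zero    = var zero
exts σ (suc i) = renV suc (σ i)

mutual
  subV : ∀ {n m} → (Fin n → Val m) → Val n → Val m
  subV σ (var i) = σ i
  subV σ (lam M) = lam (subC (exts σ) M)

  subC : ∀ {n m} → (Fin n → Val m) → Comp n → Comp m
  subC σ (ret V)   = ret (subV σ V)
  subC σ (app V M) = app (subV σ V) (subC σ M)

sub0 : ∀ {n} → Val n → Fin (suc n) → Val n
sub0 V zero    = V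
sub0 V (suc i) = var i

_[_] : ∀ {n} → Comp (suc n) → Val n → Comp n
M [ V ] = subC (sub0 V) M

data Rule : Set where
  σ βc : Rule

-- In (λy.N)((λx.M)L) ↦ (λx.(λy.N)M)L, the body N (scope: y, ...) is moved
-- under the extra binder x; since x ∉ fv(N) this is the weakening of N
-- that skips index 1 (index 0 = y, index 1 = x).
data Root {n : ℕ} : Rule → Comp n → Comp n → Set where
  βc-rule : (M : Comp (suc n)) (V : Val n) →
            Root βc (app (lam M) (ret V)) (M [ V ])
  σ-rule  : (N : Comp (suc n)) (M : Comp (suc n)) (L : Comp n) →
            Root σ (app (lam N) (app (lam M) L))
                   (app (lam (app (lam (renC (ext suc) N)) M)) L)

data SCtx : ℕ → ℕ → Set where
  hole : ∀ {n} → SCtx n n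
  appS : ∀ {n m} → Val n → SCtx n m → SCtx n m
  lamS : ∀ {n m} → SCtx (suc n) m → Comp n → SCtx n m

plugS : ∀ {n m} → SCtx n m → Comp m → Comp n
plugS hole       P = P
plugS (appS V S) P = app V (plugS S P)
plugS (lamS S M) P = app (lam (plugS S P)) M

data WCtx (n : ℕ) : Set where
  hole : WCtx n
  appW : Val n → WCtx n → WCtx n

plugW : ∀ {n} → WCtx n → Comp n → Comp n
plugW hole       P = P
plugW (appW V W) P = app V (plugW W P)

LRed : Set₁
LRed = ∀ {n} → Rule → Comp n → Comp n → Set

data _⟶s[_]_ {n : ℕ} : Comp n → Rule → Comp n → Set where
  sctx : ∀ {m l} (S : SCtx n m) {P Q : Comp m} → Root l P Q →
         plugS S P ⟶s[ l ] plugS S Q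

data _⟶w[_]_ {n : ℕ} : Comp n → Rule → Comp n → Set where
  wctx : ∀ {l} (W : WCtx n) {P Q : Comp n} → Root l P Q →
         plugW W P ⟶w[ l ] plugW W Q

surfaceσβc : LRed
surfaceσβc l M N = M ⟶s[ l ] N

weakσβc : LRed
weakσβc l M N = M ⟶w[ l ] N

-- Generic notions for a labelled reduction R (its unlabelled reduction
-- is M → N iff R l M N for some rule l).

module _ (R : LRed) where

  Normal : ∀ {n} → Comp n → Set
  Normal M = ¬ (Σ Rule λ l → Σ _ λ N → R l M N)

  data Path {n : ℕ} : Comp n → Comp n → Set where
    done : ∀ {M} → Path M M
    step : ∀ {M N L} (l : Rule) → R l M N → Path N L → Path M L

  βcount : ∀ {n} {M N : Comp n} → Path M N → ℕ
  βcount done            = 0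
  βcount (step σ  _ p)   = βcount p
  βcount (step βc _ p)   = suc (βcount p)

  record InfSeq {n : ℕ} (M : Comp n) : Set where
    field
      term  : ℕ → Comp n
      label : ℕ → Rule
      start : term 0 ≡ M
      steps : ∀ i → R (label i) (term i) (term (suc i))

  βprefix : (ℕ → Rule) → ℕ → ℕ
  βprefix f zero    = 0
  βprefix f (suc k) with f k
  ... | σ  = βprefix f k
  ... | βc = suc (βprefix f k)

  WN : ∀ {n} → Comp n → Set
  WN M = Σ _ λ N → Path M N × Normal N

  SN : ∀ {n} → Comp n → Set
  SN M = ¬ InfSeq M

  UniformlyNormalizing : Set
  UniformlyNormalizing = ∀ {n} (M : Comp n) → WN M → SN M

  data MaxSeq {n : ℕ} (M : Comp n) : Set where
    finite   : ∀ {N} (p : Path M N) → Normal N → MaxSeq M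
    infinite : InfSeq M → MaxSeq M

  -- "s contains at least k βc steps" (number of βc steps in ℕ ∪ {∞})
  AtLeastβ : ∀ {n} {M : Comp n} → MaxSeq M → ℕ → Set
  AtLeastβ (finite p _) k = k ≤ βcount p
  AtLeastβ (infinite s) k = ∃[ j ] (k ≤ βprefix (InfSeq.label s) j)

  SameβCount : Set
  SameβCount = ∀ {n} (M : Comp n) (s t : MaxSeq M) (k : ℕ) →
               (AtLeastβ s k → AtLeastβ t k) × (AtLeastβ t k → AtLeastβ s k)

-- σ-steps shrink a weighted size, so σ alone terminates.  Both reductions
-- admit a βc-potential: a number k attached to M that σ-steps keep, each
-- βc-step lowers by one, that is 0 on normal forms and that equals the
-- βc-count of any sequence from M to a normal form.  Lexicographic induction
-- on (k, size) then excludes infinite sequences from weakly normalising terms,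
-- and the potential is the βc-count of every maximal sequence.  For surface
-- reduction every peak closes with equally many βc-steps on both sides
-- (random descent), which makes the βc-count of normalising sequences such a
-- potential.  Weak reduction is not confluent, but its βc-steps are
-- deterministic and commute with σ-steps, so the length of the βc-only
-- sequence serves instead.

module Submission where

open import Defs
open import Data.Nat using (ℕ; zero; suc; _+_; _≤_; _<_; z≤n; s≤s)
open import Data.Nat.Properties
open import Data.Nat.Induction using (<-wellFounded)
open import Data.Nat.Solver using (module +-*-Solver)
open import Data.Fin using (Fin; zero; suc)
open import Data.Product using (Σ; _×_; _,_; ∃)
open import Data.Product.Relation.Binary.Lex.Strict using (×-Lex; ×-wellFounded)
open import Data.Sum using (inj₁; inj₂)
open import Data.Empty using (⊥; ⊥-elim)
open import Function using (_∘_)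
open import Induction.WellFounded using (Acc; acc; WellFounded)
open import Relation.Nullary using (¬_)
open import Relation.Binary.Construct.Closure.Reflexive as Reflexive using (ReflClosure)
open import Relation.Binary.PropositionalEquality hiding ([_])

open InfSeq

βweight : Rule → ℕ
βweight σ  = 0
βweight βc = 1

module LabelledReduction (R : LRed) where

  _++_ : ∀ {n} {M N L : Comp n} → Path R M N → Path R N L → Path R M L
  done       ++ q = q
  step l r p ++ q = step l r (p ++ q)

  βcount-step : ∀ {n} {M N L : Comp n} l (r : R l M N) (p : Path R N L) →
                βcount R (step l r p) ≡ βweight l + βcount R p
  βcount-step σ  r p = refl
  βcount-step βc r p = refl

  βcount-single : ∀ {n} {M N : Comp n} l (r : R l M N) → βcount R (step l r done) ≡ βweight l
  βcount-single σ  r = refl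
  βcount-single βc r = refl

  βcount-cons : ∀ {n} {M N L : Comp n} {k k₁ k₂} l (r : R l M N) (p : Path R N L) →
                βweight l + k₁ ≡ k → βcount R p + k₂ ≡ k₁ → βcount R (step l r p) + k₂ ≡ k
  βcount-cons {k₂ = k₂} l r p e e′ = begin
    βcount R (step l r p) + k₂    ≡⟨ cong (_+ k₂) (βcount-step l r p) ⟩
    βweight l + βcount R p + k₂   ≡⟨ +-assoc (βweight l) _ k₂ ⟩
    βweight l + (βcount R p + k₂) ≡⟨ cong (βweight l +_) e′ ⟩
    βweight l + _                 ≡⟨ e ⟩
    _                             ∎
    where open ≡-Reasoning

  βcount-++ : ∀ {n} {M N L : Comp n} (p : Path R M N) (q : Path R N L) →
              βcount R (p ++ q) ≡ βcount R p + βcount R q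
  βcount-++ done         q = refl
  βcount-++ (step σ r p)  q = βcount-++ p q
  βcount-++ (step βc r p) q = cong suc (βcount-++ p q)

  βprefix-suc : ∀ (f : ℕ → Rule) i → βprefix R f (suc i) ≡ βweight (f i) + βprefix R f i
  βprefix-suc f i with f i
  ... | σ  = refl
  ... | βc = refl

  Path-map : ∀ {n m} (f : Comp n → Comp m) → (∀ {l P Q} → R l P Q → R l (f P) (f Q)) →
             ∀ {M N} → Path R M N → Path R (f M) (f N)
  Path-map f f-step done         = done
  Path-map f f-step (step l r p) = step l (f-step r) (Path-map f f-step p)

  βcount-Path-map : ∀ {n m} (f : Comp n → Comp m) (f-step : ∀ {l P Q} → R l P Q → R l (f P) (f Q))
                    {M N} (p : Path R M N) → βcount R (Path-map f f-step p) ≡ βcount R p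
  βcount-Path-map f f-step done          = refl
  βcount-Path-map f f-step (step σ r p)  = βcount-Path-map f f-step p
  βcount-Path-map f f-step (step βc r p) = cong suc (βcount-Path-map f f-step p)

  NormalisesWith : ∀ {n} → Comp n → ℕ → Set
  NormalisesWith M k = ∃ λ N → Σ (Path R M N) λ p → Normal R N × βcount R p ≡ k

  Balanced : ∀ {n} → Rule → Rule → Comp n → Comp n → Set
  Balanced a b N₁ N₂ = ∃ λ P → Σ (Path R N₁ P) λ q₁ → Σ (Path R N₂ P) λ q₂ →
                       βweight a + βcount R q₁ ≡ βweight b + βcount R q₂

  LocallyBalanced : Set
  LocallyBalanced = ∀ {n a b} {M N₁ N₂ : Comp n} → R a M N₁ → R b M N₂ → Balanced a b N₁ N₂

  Balanced-sym : ∀ {n a b} {N₁ N₂ : Comp n} → Balanced a b N₁ N₂ → Balanced b a N₂ N₁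
  Balanced-sym (P , q₁ , q₂ , e) = P , q₂ , q₁ , sym e

  Balanced-diamond : ∀ {n a b} {N₁ N₂ P : Comp n} → R b N₁ P → R a N₂ P → Balanced a b N₁ N₂
  Balanced-diamond {a = a} {b} r₁ r₂ = _ , step b r₁ done , step a r₂ done , (begin
    βweight a + βcount R (step b r₁ done) ≡⟨ cong (βweight a +_) (βcount-single b r₁) ⟩
    βweight a + βweight b                 ≡⟨ +-comm (βweight a) (βweight b) ⟩
    βweight b + βweight a                 ≡⟨ cong (βweight b +_) (βcount-single a r₂) ⟨
    βweight b + βcount R (step a r₂ done) ∎)
    where open ≡-Reasoning

  Balanced-map : ∀ {n m a b} (f : Comp n → Comp m) → (∀ {l P Q} → R l P Q → R l (f P) (f Q)) →
                 ∀ {N₁ N₂} → Balanced a b N₁ N₂ → Balanced a b (f N₁) (f N₂)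
  Balanced-map {a = a} {b} f f-step (P , q₁ , q₂ , e) =
    f P , Path-map f f-step q₁ , Path-map f f-step q₂ ,
    trans (cong (βweight a +_) (βcount-Path-map f f-step q₁))
          (trans e (cong (βweight b +_) (sym (βcount-Path-map f f-step q₂))))

_⊏_ : ℕ × ℕ → ℕ × ℕ → Set
_⊏_ = ×-Lex _≡_ _<_ _<_

⊏-wellFounded : WellFounded _⊏_
⊏-wellFounded = ×-wellFounded <-wellFounded <-wellFounded

module σTerminating (R : LRed) (μ : ∀ {n} → Comp n → ℕ)
                    (μ-σ : ∀ {n} {M N : Comp n} → R σ M N → μ N < μ M) where

  open LabelledReduction R

  potential-decreases : ∀ {n a k k′} {M N : Comp n} → R a M N → βweight a + k′ ≡ k →
                        (k′ , μ N) ⊏ (k , μ M)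
  potential-decreases {a = σ}  r refl = inj₂ (refl , μ-σ r)
  potential-decreases {a = βc} r refl = inj₁ ≤-refl

  eventuallyβc : ∀ {n} {M : Comp n} (s : InfSeq R M) i → Acc _<_ (μ (term s i)) →
           ∃ λ j → suc (βprefix R (label s) i) ≤ βprefix R (label s) j
  eventuallyβc s i (acc rs) = by-label (label s i) (steps s i) (βprefix-suc (label s) i)
    where
    by-label : ∀ l → R l (term s i) (term s (suc i)) →
           βprefix R (label s) (suc i) ≡ βweight l + βprefix R (label s) i →
           ∃ λ j → suc (βprefix R (label s) i) ≤ βprefix R (label s) j
    by-label σ r e with j , h ← eventuallyβc s (suc i) (rs (μ-σ r)) = j , subst (λ x → suc x ≤ _) e h
    by-label βc r e = suc i , ≤-reflexive (sym e)

  infinitelyManyβc : ∀ {n} {M : Comp n} (s : InfSeq R M) k → ∃ λ j → k ≤ βprefix R (label s) j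
  infinitelyManyβc s zero    = 0 , z≤n
  infinitelyManyβc s (suc k) with j , h ← infinitelyManyβc s k
                             with j′ , h′ ← eventuallyβc s j (<-wellFounded _) =
    j′ , ≤-trans (s≤s h) h′

  module Potential (I : ∀ {n} → Comp n → ℕ → Set)
    (I-step   : ∀ {n a k} {M N : Comp n} → I M k → R a M N → ∃ λ k′ → βweight a + k′ ≡ k × I N k′)
    (I-normal : ∀ {n k} {M : Comp n} → Normal R M → I M k → k ≡ 0)
    (I-path   : ∀ {n} {M N : Comp n} (p : Path R M N) → Normal R N → I M (βcount R p))
    where

    noInfiniteFrom : ∀ {n k} {M : Comp n} (s : InfSeq R M) i →
                     Acc _⊏_ (k , μ (term s i)) → I (term s i) k → ⊥
    noInfiniteFrom s i (acc rs) h with k′ , e , h′ ← I-step h (steps s i) =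
      noInfiniteFrom s (suc i) (rs (potential-decreases (steps s i) e)) h′

    uniformlyNormalizing : UniformlyNormalizing R
    uniformlyNormalizing M (N , p , nf) s =
      noInfiniteFrom s 0 (⊏-wellFounded _) (subst (λ X → I X (βcount R p)) (sym (start s)) (I-path p nf))

    I-along : ∀ {n j} {M N : Comp n} → I M j → (q : Path R M N) → ∃ λ k → βcount R q + k ≡ j × I N k
    I-along h done = _ , refl , h
    I-along h (step a r q) with k′ , e , h′ ← I-step h r with k , e′ , h″ ← I-along h′ q =
      k , βcount-cons a r q e e′ , h″

    normalising-sameβcount : ∀ {n} {M N N′ : Comp n} (p : Path R M N) → Normal R N →
                             (q : Path R M N′) → Normal R N′ → βcount R p ≡ βcount R q
    normalising-sameβcount p nf q nf′ with k , e , h ← I-along (I-path p nf) q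
      rewrite I-normal nf′ h = trans (sym e) (+-identityʳ _)

    atLeastβ-transfer : ∀ {n} {M : Comp n} (s t : MaxSeq R M) k → AtLeastβ R s k → AtLeastβ R t k
    atLeastβ-transfer (finite p nf) (finite q nf′) k h = subst (k ≤_) (normalising-sameβcount p nf q nf′) h
    atLeastβ-transfer (finite p nf) (infinite t)   k h = ⊥-elim (uniformlyNormalizing _ (_ , p , nf) t)
    atLeastβ-transfer (infinite s)  (finite q nf)  k h = ⊥-elim (uniformlyNormalizing _ (_ , q , nf) s)
    atLeastβ-transfer (infinite s)  (infinite t)   k h = infinitelyManyβc t k

    sameβCount : SameβCount R
    sameβCount M s t k = atLeastβ-transfer s t k , atLeastβ-transfer t s k

  module RandomDescent (balanced : LocallyBalanced) where

    NormalisesWith-along : ∀ {n k} {M Q : Comp n} → Acc _⊏_ (k , μ M) → NormalisesWith M k →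
                           (q : Path R M Q) → ∃ λ k′ → βcount R q + k′ ≡ k × NormalisesWith Q k′
    NormalisesWith-along _ h done = _ , refl , h
    NormalisesWith-along _ (_ , done , nf , _) (step a r q) = ⊥-elim (nf (a , _ , r))
    -- Close the peak between r and the first step r′ of the normalising sequence:
    -- the induction hypothesis carries normalisation along q₂, so N normalises
    -- through q₁ with a count fixed by the balance, and we continue along q.
    NormalisesWith-along (acc rs) (_ , step b r′ p , nf , refl) (step a r q)
      with P , q₁ , q₂ , bal ← balanced r r′
      with k₃ , e₃ , (_ , p₃ , nf₃ , refl) ←
             NormalisesWith-along (rs (potential-decreases r′ (sym (βcount-step b r′ p)))) (_ , p , nf , refl) q₂
      = let k , e , h = NormalisesWith-along (rs (potential-decreases r N-count)) N-normalises q
        in  k , βcount-cons a r q N-count e , h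
      where
      N-normalises : NormalisesWith _ (βcount R q₁ + k₃)
      N-normalises = _ , q₁ ++ p₃ , nf₃ , βcount-++ q₁ p₃

      N-count : βweight a + (βcount R q₁ + k₃) ≡ βcount R (step b r′ p)
      N-count = begin
        βweight a + (βcount R q₁ + k₃) ≡⟨ +-assoc (βweight a) _ k₃ ⟨
        βweight a + βcount R q₁ + k₃   ≡⟨ cong (_+ k₃) bal ⟩
        βweight b + βcount R q₂ + k₃   ≡⟨ +-assoc (βweight b) _ k₃ ⟩
        βweight b + (βcount R q₂ + k₃) ≡⟨ cong (βweight b +_) e₃ ⟩
        βweight b + βcount R p         ≡⟨ βcount-step b r′ p ⟨
        βcount R (step b r′ p)         ∎
        where open ≡-Reasoning

    NormalisesWith-step : ∀ {n a k} {M N : Comp n} → NormalisesWith M k → R a M N →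
                          ∃ λ k′ → βweight a + k′ ≡ k × NormalisesWith N k′
    NormalisesWith-step {a = a} h r
      with k′ , e , h′ ← NormalisesWith-along (⊏-wellFounded _) h (step a r done) =
      k′ , trans (cong (_+ k′) (sym (βcount-single a r))) e , h′

    NormalisesWith-normal : ∀ {n k} {M : Comp n} → Normal R M → NormalisesWith M k → k ≡ 0
    NormalisesWith-normal nf (_ , done , _ , e) = sym e
    NormalisesWith-normal nf (_ , step a r p , _ , _) = ⊥-elim (nf (a , _ , r))

    open Potential NormalisesWith NormalisesWith-step NormalisesWith-normal (λ p nf → _ , p , nf , refl) public

ext-ext : ∀ {n m k} {ρ : Fin n → Fin m} {ρ′ : Fin m → Fin k} {τ : Fin n → Fin k} →
          ρ′ ∘ ρ ≗ τ → ext ρ′ ∘ ext ρ ≗ ext τ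
ext-ext h zero    = refl
ext-ext h (suc i) = cong suc (h i)

mutual
  renV-renV : ∀ {n m k} {ρ : Fin n → Fin m} {ρ′ : Fin m → Fin k} {τ : Fin n → Fin k} →
              ρ′ ∘ ρ ≗ τ → renV ρ′ ∘ renV ρ ≗ renV τ
  renV-renV h (var i) = cong var (h i)
  renV-renV h (lam M) = cong lam (renC-renC (ext-ext h) M)

  renC-renC : ∀ {n m k} {ρ : Fin n → Fin m} {ρ′ : Fin m → Fin k} {τ : Fin n → Fin k} →
              ρ′ ∘ ρ ≗ τ → renC ρ′ ∘ renC ρ ≗ renC τ
  renC-renC h (ret V)   = cong ret (renV-renV h V)
  renC-renC h (app V M) = cong₂ app (renV-renV h V) (renC-renC h M)

exts-ext : ∀ {n m k} {ρ : Fin n → Fin m} {θ : Fin m → Val k} {τ : Fin n → Val k} →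
           θ ∘ ρ ≗ τ → exts θ ∘ ext ρ ≗ exts τ
exts-ext h zero    = refl
exts-ext h (suc i) = cong (renV suc) (h i)

mutual
  subV-renV : ∀ {n m k} {ρ : Fin n → Fin m} {θ : Fin m → Val k} {τ : Fin n → Val k} →
              θ ∘ ρ ≗ τ → subV θ ∘ renV ρ ≗ subV τ
  subV-renV h (var i) = h i
  subV-renV h (lam M) = cong lam (subC-renC (exts-ext h) M)

  subC-renC : ∀ {n m k} {ρ : Fin n → Fin m} {θ : Fin m → Val k} {τ : Fin n → Val k} →
              θ ∘ ρ ≗ τ → subC θ ∘ renC ρ ≗ subC τ
  subC-renC h (ret V)   = cong ret (subV-renV h V)
  subC-renC h (app V M) = cong₂ app (subV-renV h V) (subC-renC h M)

ext-exts : ∀ {n m k} {θ : Fin n → Val m} {ρ : Fin m → Fin k} {τ : Fin n → Val k} →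
           renV ρ ∘ θ ≗ τ → renV (ext ρ) ∘ exts θ ≗ exts τ
ext-exts h zero    = refl
ext-exts {θ = θ} h (suc i) =
  trans (renV-renV (λ _ → refl) (θ i)) (trans (sym (renV-renV (λ _ → refl) (θ i))) (cong (renV suc) (h i)))

mutual
  renV-subV : ∀ {n m k} {θ : Fin n → Val m} {ρ : Fin m → Fin k} {τ : Fin n → Val k} →
              renV ρ ∘ θ ≗ τ → renV ρ ∘ subV θ ≗ subV τ
  renV-subV h (var i) = h i
  renV-subV h (lam M) = cong lam (renC-subC (ext-exts h) M)

  renC-subC : ∀ {n m k} {θ : Fin n → Val m} {ρ : Fin m → Fin k} {τ : Fin n → Val k} →
              renV ρ ∘ θ ≗ τ → renC ρ ∘ subC θ ≗ subC τ
  renC-subC h (ret V)   = cong ret (renV-subV h V)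
  renC-subC h (app V M) = cong₂ app (renV-subV h V) (renC-subC h M)

exts-exts : ∀ {n m k} {θ : Fin n → Val m} {θ′ : Fin m → Val k} {τ : Fin n → Val k} →
            subV θ′ ∘ θ ≗ τ → subV (exts θ′) ∘ exts θ ≗ exts τ
exts-exts h zero    = refl
exts-exts {θ = θ} h (suc i) =
  trans (subV-renV (λ _ → refl) (θ i)) (trans (sym (renV-subV (λ _ → refl) (θ i))) (cong (renV suc) (h i)))

mutual
  subV-subV : ∀ {n m k} {θ : Fin n → Val m} {θ′ : Fin m → Val k} {τ : Fin n → Val k} →
              subV θ′ ∘ θ ≗ τ → subV θ′ ∘ subV θ ≗ subV τ
  subV-subV h (var i) = h i
  subV-subV h (lam M) = cong lam (subC-subC (exts-exts h) M)

  subC-subC : ∀ {n m k} {θ : Fin n → Val m} {θ′ : Fin m → Val k} {τ : Fin n → Val k} →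
              subV θ′ ∘ θ ≗ τ → subC θ′ ∘ subC θ ≗ subC τ
  subC-subC h (ret V)   = cong ret (subV-subV h V)
  subC-subC h (app V M) = cong₂ app (subV-subV h V) (subC-subC h M)

exts-var : ∀ {n} {θ : Fin n → Val n} → θ ≗ var → exts θ ≗ var
exts-var h zero    = refl
exts-var h (suc i) = cong (renV suc) (h i)

mutual
  subV-var : ∀ {n} {θ : Fin n → Val n} → θ ≗ var → ∀ V → subV θ V ≡ V
  subV-var h (var i) = h i
  subV-var h (lam M) = cong lam (subC-var (exts-var h) M)

  subC-var : ∀ {n} {θ : Fin n → Val n} → θ ≗ var → ∀ M → subC θ M ≡ M
  subC-var h (ret V)   = cong ret (subV-var h V)
  subC-var h (app V M) = cong₂ app (subV-var h V) (subC-var h M)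

weaken₁ : ∀ {n} → Comp (suc n) → Comp (suc (suc n))
weaken₁ = renC (ext suc)

weaken₁-[] : ∀ {n} (W : Val n) (N : Comp (suc n)) → subC (exts (sub0 W)) (weaken₁ N) ≡ N
weaken₁-[] W N = trans (subC-renC {τ = var} h N) (subC-var (λ _ → refl) N)
  where
  h : exts (sub0 W) ∘ ext suc ≗ var
  h zero    = refl
  h (suc i) = refl

renC-[] : ∀ {n m} (ρ : Fin n → Fin m) (K : Comp (suc n)) (V : Val n) →
          renC ρ (K [ V ]) ≡ renC (ext ρ) K [ renV ρ V ]
renC-[] ρ K V = trans (renC-subC (λ _ → refl) K) (sym (subC-renC h K))
  where
  h : sub0 (renV ρ V) ∘ ext ρ ≗ renV ρ ∘ sub0 V
  h zero    = refl
  h (suc i) = refl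

subC-[] : ∀ {n m} (θ : Fin n → Val m) (K : Comp (suc n)) (V : Val n) →
          subC θ (K [ V ]) ≡ subC (exts θ) K [ subV θ V ]
subC-[] θ K V = trans (subC-subC (λ _ → refl) K) (sym (subC-subC h K))
  where
  h : subV (sub0 (subV θ V)) ∘ exts θ ≗ subV θ ∘ sub0 V
  h zero    = refl
  h (suc i) = trans (subV-renV {τ = var} (λ _ → refl) (θ i)) (subV-var (λ _ → refl) (θ i))

renC-weaken₁ : ∀ {n m} (ρ : Fin n → Fin m) (N : Comp (suc n)) →
               renC (ext (ext ρ)) (weaken₁ N) ≡ weaken₁ (renC (ext ρ) N)
renC-weaken₁ ρ N = trans (renC-renC h N) (sym (renC-renC (λ _ → refl) N))
  where
  h : ext (ext ρ) ∘ ext suc ≗ ext suc ∘ ext ρ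
  h zero    = refl
  h (suc i) = refl

subC-weaken₁ : ∀ {n m} (θ : Fin n → Val m) (N : Comp (suc n)) →
               subC (exts (exts θ)) (weaken₁ N) ≡ weaken₁ (subC (exts θ) N)
subC-weaken₁ θ N = trans (subC-renC h N) (sym (renC-subC (λ _ → refl) N))
  where
  h : exts (exts θ) ∘ ext suc ≗ renV (ext suc) ∘ exts θ
  h zero    = refl
  h (suc i) = trans (renV-renV (λ _ → refl) (θ i)) (sym (renV-renV (λ _ → refl) (θ i)))

Root-βc-after-σ : ∀ {n} (A B : Comp (suc n)) (W : Val n) →
                  Root βc (app (lam (app (lam (weaken₁ A)) B)) (ret W)) (app (lam A) (B [ W ]))
Root-βc-after-σ A B W = subst (Root βc _) (cong (λ X → app (lam X) (B [ W ])) (weaken₁-[] W A)) (βc-rule _ W)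

Root-renC : ∀ {n m l} (ρ : Fin n → Fin m) {P Q : Comp n} → Root l P Q → Root l (renC ρ P) (renC ρ Q)
Root-renC ρ (βc-rule K V)  = subst (Root βc _) (sym (renC-[] ρ K V)) (βc-rule _ _)
Root-renC ρ (σ-rule N M L) =
  subst (Root σ _) (cong (λ X → app (lam (app (lam X) (renC (ext ρ) M))) (renC ρ L)) (sym (renC-weaken₁ ρ N)))
        (σ-rule _ _ _)

Root-subC : ∀ {n m l} (θ : Fin n → Val m) {P Q : Comp n} → Root l P Q → Root l (subC θ P) (subC θ Q)
Root-subC θ (βc-rule K V)  = subst (Root βc _) (sym (subC-[] θ K V)) (βc-rule _ _)
Root-subC θ (σ-rule N M L) =
  subst (Root σ _) (cong (λ X → app (lam (app (lam X) (subC (exts θ) M))) (subC θ L)) (sym (subC-weaken₁ θ N)))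
        (σ-rule _ _ _)

data _⇒s[_]_ {n : ℕ} : Comp n → Rule → Comp n → Set where
  root : ∀ {l P Q} → Root l P Q → P ⇒s[ l ] Q
  arg  : ∀ {l V P Q} → P ⇒s[ l ] Q → app V P ⇒s[ l ] app V Q
  body : ∀ {l P Q M} → P ⇒s[ l ] Q → app (lam P) M ⇒s[ l ] app (lam Q) M

data _⇒w[_]_ {n : ℕ} : Comp n → Rule → Comp n → Set where
  root : ∀ {l P Q} → Root l P Q → P ⇒w[ l ] Q
  arg  : ∀ {l V P Q} → P ⇒w[ l ] Q → app V P ⇒w[ l ] app V Q

plugS-⇒s : ∀ {n m l} (S : SCtx n m) {P Q : Comp m} → Root l P Q → plugS S P ⇒s[ l ] plugS S Q
plugS-⇒s hole       r = root r
plugS-⇒s (appS V S) r = arg (plugS-⇒s S r)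
plugS-⇒s (lamS S M) r = body (plugS-⇒s S r)

⟶s⊆⇒s : ∀ {n l} {M N : Comp n} → M ⟶s[ l ] N → M ⇒s[ l ] N
⟶s⊆⇒s (sctx S r) = plugS-⇒s S r

⟶s-arg : ∀ {n l} {V : Val n} {P Q : Comp n} → P ⟶s[ l ] Q → app V P ⟶s[ l ] app V Q
⟶s-arg (sctx S r) = sctx (appS _ S) r

⟶s-body : ∀ {n l} {M : Comp n} {P Q : Comp (suc n)} → P ⟶s[ l ] Q → app (lam P) M ⟶s[ l ] app (lam Q) M
⟶s-body (sctx S r) = sctx (lamS S _) r

⇒s⊆⟶s : ∀ {n l} {M N : Comp n} → M ⇒s[ l ] N → M ⟶s[ l ] N
⇒s⊆⟶s (root r) = sctx hole r
⇒s⊆⟶s (arg s)  = ⟶s-arg (⇒s⊆⟶s s)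
⇒s⊆⟶s (body s) = ⟶s-body (⇒s⊆⟶s s)

plugW-⇒w : ∀ {n l} (W : WCtx n) {P Q : Comp n} → Root l P Q → plugW W P ⇒w[ l ] plugW W Q
plugW-⇒w hole       r = root r
plugW-⇒w (appW V W) r = arg (plugW-⇒w W r)

⟶w⊆⇒w : ∀ {n l} {M N : Comp n} → M ⟶w[ l ] N → M ⇒w[ l ] N
⟶w⊆⇒w (wctx W r) = plugW-⇒w W r

⇒w⊆⟶w : ∀ {n l} {M N : Comp n} → M ⇒w[ l ] N → M ⟶w[ l ] N
⇒w⊆⟶w (root r) = wctx hole r
⇒w⊆⟶w (arg {V = V} s) with wctx W r ← ⇒w⊆⟶w s = wctx (appW V W) r

⇒w⊆⇒s : ∀ {n l} {M N : Comp n} → M ⇒w[ l ] N → M ⇒s[ l ] N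
⇒w⊆⇒s (root r) = root r
⇒w⊆⇒s (arg s)  = arg (⇒w⊆⇒s s)

⇒s-renC : ∀ {n m l} (ρ : Fin n → Fin m) {P Q : Comp n} → P ⇒s[ l ] Q → renC ρ P ⇒s[ l ] renC ρ Q
⇒s-renC ρ (root r) = root (Root-renC ρ r)
⇒s-renC ρ (arg s)  = arg (⇒s-renC ρ s)
⇒s-renC ρ (body s) = body (⇒s-renC (ext ρ) s)

⇒s-subC : ∀ {n m l} (θ : Fin n → Val m) {P Q : Comp n} → P ⇒s[ l ] Q → subC θ P ⇒s[ l ] subC θ Q
⇒s-subC θ (root r) = root (Root-subC θ r)
⇒s-subC θ (arg s)  = arg (⇒s-subC θ s)
⇒s-subC θ (body s) = body (⇒s-subC (exts θ) s)

-- Arguments count twice, so that σ, which takes L out of one argument position, shrinks the size.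
mutual
  sizeC : ∀ {n} → Comp n → ℕ
  sizeC (ret V)   = 1
  sizeC (app V M) = sizeV V + (sizeC M + sizeC M)

  sizeV : ∀ {n} → Val n → ℕ
  sizeV (var _) = 1
  sizeV (lam M) = sizeC M

mutual
  sizeC-renC : ∀ {n m} (ρ : Fin n → Fin m) (M : Comp n) → sizeC (renC ρ M) ≡ sizeC M
  sizeC-renC ρ (ret V)   = refl
  sizeC-renC ρ (app V M) = cong₂ _+_ (sizeV-renV ρ V) (cong₂ _+_ (sizeC-renC ρ M) (sizeC-renC ρ M))

  sizeV-renV : ∀ {n m} (ρ : Fin n → Fin m) (V : Val n) → sizeV (renV ρ V) ≡ sizeV V
  sizeV-renV ρ (var _) = refl
  sizeV-renV ρ (lam M) = sizeC-renC (ext ρ) M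

sizeC-positive : ∀ {n} (M : Comp n) → 0 < sizeC M
sizeC-positive (ret V)   = s≤s z≤n
sizeC-positive (app V M) = ≤-trans (sizeC-positive M) (≤-trans (m≤m+n _ _) (m≤n+m _ (sizeV V)))

Root-σ-shrinks : ∀ {n} {P Q : Comp n} → Root σ P Q → sizeC Q < sizeC P
Root-σ-shrinks (σ-rule N M L) = begin-strict
  sizeC (weaken₁ N) + (y + y) + (z + z)   ≡⟨ cong (λ w → w + (y + y) + (z + z)) (sizeC-renC (ext suc) N) ⟩
  x + (y + y) + (z + z)                   <⟨ m<m+n _ (≤-trans (sizeC-positive L) (m≤m+n z z)) ⟩
  x + (y + y) + (z + z) + (z + z)         ≡⟨ solve 3 (λ x y z → x :+ (y :+ y) :+ (z :+ z) :+ (z :+ z)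
                                                      := x :+ ((y :+ (z :+ z)) :+ (y :+ (z :+ z)))) refl x y z ⟩
  x + ((y + (z + z)) + (y + (z + z)))     ∎
  where
  open ≤-Reasoning
  open +-*-Solver
  x = sizeC N
  y = sizeC M
  z = sizeC L

⇒s-σ-shrinks : ∀ {n} {P Q : Comp n} → P ⇒s[ σ ] Q → sizeC Q < sizeC P
⇒s-σ-shrinks (root r)         = Root-σ-shrinks r
⇒s-σ-shrinks (arg {V = V} s)  = +-monoʳ-< (sizeV V) (+-mono-< (⇒s-σ-shrinks s) (⇒s-σ-shrinks s))
⇒s-σ-shrinks (body {M = M} s) = +-monoˡ-< (sizeC M + sizeC M) (⇒s-σ-shrinks s)

open LabelledReduction surfaceσβc
  using (Balanced; LocallyBalanced; Balanced-sym; Balanced-diamond; Balanced-map)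

single : ∀ {n l} {M N : Comp n} → M ⇒s[ l ] N → Path surfaceσβc M N
single {l = l} s = step l (⇒s⊆⟶s s) done

diamond : ∀ {n a b} {N₁ N₂ P : Comp n} → N₁ ⇒s[ b ] P → N₂ ⇒s[ a ] P → Balanced a b N₁ N₂
diamond s₁ s₂ = Balanced-diamond (⇒s⊆⟶s s₁) (⇒s⊆⟶s s₂)

Root-peak : ∀ {n a b} {M N₁ N₂ : Comp n} → Root a M N₁ → M ⇒s[ b ] N₂ → Balanced a b N₁ N₂
Root-peak (βc-rule K W) (root (βc-rule .K .W)) = _ , done , done , refl
Root-peak (βc-rule K W) (arg (root ()))
Root-peak (βc-rule K W) (body s) = diamond (⇒s-subC (sub0 W) s) (root (βc-rule _ W))
Root-peak (σ-rule A B L) (root (σ-rule .A .B .L)) = _ , done , done , refl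
Root-peak (σ-rule A B .(ret W)) (arg (root (βc-rule .B W))) =
  _ , single (root (Root-βc-after-σ A B W)) , done , refl
Root-peak (σ-rule A B .(app (lam C) L)) (arg (root (σ-rule .B C L))) =
  _ , single (root (subst (Root σ _) e (σ-rule _ C L))) ,
  step σ (⇒s⊆⟶s (root (σ-rule A _ L))) (single (body (root (σ-rule _ _ C)))) , refl
  where
  e : app (lam (app (lam (weaken₁ (app (lam (weaken₁ A)) B))) C)) L
    ≡ app (lam (app (lam (app (lam (weaken₁ (weaken₁ A))) (weaken₁ B))) C)) L
  e = cong (λ X → app (lam (app (lam (app (lam X) (weaken₁ B))) C)) L) (renC-weaken₁ suc A)
Root-peak (σ-rule A B L) (arg (arg s))  = diamond (arg s) (root (σ-rule A B _))
Root-peak (σ-rule A B L) (arg (body s)) = diamond (body (arg s)) (root (σ-rule A _ L))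
Root-peak (σ-rule A B L) (body s)       = diamond (body (body (⇒s-renC (ext suc) s))) (root (σ-rule _ B L))

⇒s-peak : ∀ {n a b} {M N₁ N₂ : Comp n} → M ⇒s[ a ] N₁ → M ⇒s[ b ] N₂ → Balanced a b N₁ N₂
⇒s-peak (root r) s          = Root-peak r s
⇒s-peak s (root r)          = Balanced-sym (Root-peak r s)
⇒s-peak (arg s₁) (arg s₂)   = Balanced-map (app _) ⟶s-arg (⇒s-peak s₁ s₂)
⇒s-peak (arg s₁) (body s₂)  = diamond (body s₂) (arg s₁)
⇒s-peak (body s₁) (arg s₂)  = diamond (arg s₂) (body s₁)
⇒s-peak (body s₁) (body s₂) = Balanced-map (λ X → app (lam X) _) ⟶s-body (⇒s-peak s₁ s₂)

surface-locallyBalanced : LocallyBalanced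
surface-locallyBalanced r₁ r₂ = ⇒s-peak (⟶s⊆⇒s r₁) (⟶s⊆⇒s r₂)

⇒w-βc-deterministic : ∀ {n} {M N₁ N₂ : Comp n} → M ⇒w[ βc ] N₁ → M ⇒w[ βc ] N₂ → N₁ ≡ N₂
⇒w-βc-deterministic (root (βc-rule K W)) (root (βc-rule .K .W)) = refl
⇒w-βc-deterministic (root (βc-rule K W)) (arg (root ()))
⇒w-βc-deterministic (arg (root ())) (root (βc-rule K W))
⇒w-βc-deterministic (arg s₁) (arg s₂) = cong (app _) (⇒w-βc-deterministic s₁ s₂)

_⇒w[σ]⁼_ : ∀ {n} → Comp n → Comp n → Set
_⇒w[σ]⁼_ = ReflClosure (_⇒w[ σ ]_)

σ-βc-square : ∀ {n} {M N M₁ : Comp n} → M ⇒w[ σ ] N → M ⇒w[ βc ] M₁ →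
              ∃ λ N₁ → N ⇒w[ βc ] N₁ × M₁ ⇒w[σ]⁼ N₁
σ-βc-square (root (σ-rule A B L)) (root ())
σ-βc-square (root (σ-rule A B .(ret W))) (arg (root (βc-rule .B W))) =
  _ , root (Root-βc-after-σ A B W) , Reflexive.refl
σ-βc-square (root (σ-rule A B L)) (arg (arg t)) = _ , arg t , Reflexive.[ root (σ-rule A B _) ]
σ-βc-square (arg (root ())) (root (βc-rule K W))
σ-βc-square (arg (arg s)) (root ())
σ-βc-square (arg s) (arg t) with N₁ , u , rel ← σ-βc-square s t = _ , arg u , Reflexive.map arg rel

σ-reflects-βc-redex : ∀ {n} {M N N₁ : Comp n} → M ⇒w[ σ ] N → N ⇒w[ βc ] N₁ → ∃ λ M₁ → M ⇒w[ βc ] M₁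
σ-reflects-βc-redex (root (σ-rule A B .(ret W))) (root (βc-rule _ W)) = _ , arg (root (βc-rule B W))
σ-reflects-βc-redex (root (σ-rule A B L)) (arg t) = _ , arg (arg t)
σ-reflects-βc-redex (arg (root (σ-rule _ _ _))) (root ())
σ-reflects-βc-redex (arg (arg s)) (root ())
σ-reflects-βc-redex (arg s) (arg t) with M₁ , u ← σ-reflects-βc-redex s t = _ , arg u

data βcRun {n : ℕ} (M : Comp n) : ℕ → Set where
  halt : ¬ (∃ λ N → M ⇒w[ βc ] N) → βcRun M 0
  next : ∀ {N k} → M ⇒w[ βc ] N → βcRun N k → βcRun M (suc k)

βcRun-forward : ∀ {n k} {M N : Comp n} → βcRun M k → M ⇒w[σ]⁼ N → βcRun N k
βcRun-forward r Reflexive.refl = r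
βcRun-forward (halt h) Reflexive.[ s ] = halt (λ (_ , t) → h (σ-reflects-βc-redex s t))
βcRun-forward (next t r) Reflexive.[ s ] with _ , u , rel ← σ-βc-square s t = next u (βcRun-forward r rel)

βcRun-backward : ∀ {n k} {M N : Comp n} → βcRun N k → M ⇒w[σ]⁼ N → βcRun M k
βcRun-backward r Reflexive.refl = r
βcRun-backward (halt h) Reflexive.[ s ] = halt (λ (_ , t) → let N₁ , u , _ = σ-βc-square s t in h (N₁ , u))
βcRun-backward (next t r) Reflexive.[ s ]
  with _ , u ← σ-reflects-βc-redex s t
  with _ , u′ , rel ← σ-βc-square s u
  rewrite ⇒w-βc-deterministic u′ t = next u (βcRun-backward r rel)

βcRun-step : ∀ {n a k} {M N : Comp n} → βcRun M k → M ⟶w[ a ] N → ∃ λ k′ → βweight a + k′ ≡ k × βcRun N k′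
βcRun-step {a = σ}  r          s = _ , refl , βcRun-forward r Reflexive.[ ⟶w⊆⇒w s ]
βcRun-step {a = βc} (halt h)   s = ⊥-elim (h (_ , ⟶w⊆⇒w s))
βcRun-step {a = βc} (next t r) s rewrite ⇒w-βc-deterministic t (⟶w⊆⇒w s) = _ , refl , r

βcRun-normal : ∀ {n k} {M : Comp n} → Normal weakσβc M → βcRun M k → k ≡ 0
βcRun-normal nf (halt _)   = refl
βcRun-normal nf (next t r) = ⊥-elim (nf (βc , _ , ⇒w⊆⟶w t))

βcRun-path : ∀ {n} {M N : Comp n} (p : Path weakσβc M N) → Normal weakσβc N → βcRun M (βcount weakσβc p)
βcRun-path done          nf = halt (λ (_ , t) → nf (βc , _ , ⇒w⊆⟶w t))
βcRun-path (step σ r p)  nf = βcRun-backward (βcRun-path p nf) Reflexive.[ ⟶w⊆⇒w r ]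
βcRun-path (step βc r p) nf = next (⟶w⊆⇒w r) (βcRun-path p nf)

module Weak = σTerminating.Potential weakσβc sizeC (⇒s-σ-shrinks ∘ ⇒w⊆⇒s ∘ ⟶w⊆⇒w)
                βcRun βcRun-step βcRun-normal βcRun-path
module Surface = σTerminating.RandomDescent surfaceσβc sizeC (⇒s-σ-shrinks ∘ ⟶s⊆⇒s) surface-locallyBalanced

mainTheorem7 : (UniformlyNormalizing weakσβc × UniformlyNormalizing surfaceσβc)
             × (SameβCount weakσβc × SameβCount surfaceσβc)
mainTheorem7 = (Weak.uniformlyNormalizing , Surface.uniformlyNormalizing) , (Weak.sameβCount , Surface.sameβCount)
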